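{- Let $G$ be a simple plane triangulation, and let $\mathcal{H}=(H,d_G|_{V(H)},\Pi_H)$ and $\mathcal{H}'=(H',d_G|_{V(H')},\Pi_{H'})$ be configurations in $G$ whose underlying graphs are isomorphic via an isomorphism $\phi: H \to H'$ such that $d_G(v) \le d_G(\phi(v))$ for every $v \in V(H)$. If $\mathcal{H}'$ is $0$-reducible, then $\mathcal{H}$ is $0$-reducible; and if $\mathcal{H}'$ is $1/6$-reducible, then $\mathcal{H}$ is $1/6$-reducible.
   Context: A simple plane triangulation is a simple planar graph embedded in the sphere all of whose faces are triangles (a maximal planar graph); $d_G(v)$ denotes the degree of $v$ in $G$. A configuration in $G$ is a triple $(H, d_G|_{V(H)}, \Pi_H)$ where $H$ is a connected (not necessarily induced) subgraph of $G$, $d_G|_{V(H)}$ records the $G$-degrees of the vertices of $H$, and $\Pi_H$ records, for each $v\in V(H)$, the cyclic (counterclockwise) order of all edges of $G$ at $v$, with edges not in $H$ replaced by anonymous half-edges. For a finite graph $H$ and a function $\delta: V(H)\to\mathbb{Z}$ (the "effective degrees"), the pair $(H,\delta)$ is called $0$-reducible if the vertices of $H$ can be listed as $w_1,\dots,w_n$ so that for every $t$, $\delta(w_t) - |\{s<t : w_sw_t \in E(H)\}| \le 4$ (i.e. the vertices can be deleted one by one, each having effective degree at most $4$ at the moment of deletion). A configuration $\mathcal{H}$ is $0$-reducible if $(H, d_G|_{V(H)})$ is $0$-reducible. A configuration $\mathcal{H}$ with $|V(H)|\ge 6$ is $1/6$-reducible if there is a sequence of distinct vertices $v_1,\dots,v_k$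 of $H$ (a trial sequence) such that: (i) for every $i\in\{1,\dots,k\}$ for which $d_G(v_j) > \deg_H(v_j)$ holds for all $j<i$, the pair $(H - v_i, \delta_i)$ is $0$-reducible, where $\delta_i(w) = d_G(w) - [wv_i \in E(H)] - [w \in \{v_1,\dots,v_{i-1}\}]$ (Iverson brackets); and (ii) if $d_G(v_j) > \deg_H(v_j)$ for all $j\le k$, then $(H,\delta_*)$ is $0$-reducible, where $\delta_*(w) = d_G(w) - [w \in \{v_1,\dots,v_k\}]$. (Intuition: $v_i$ is the first trial vertex with no fifth-colored neighbor outside $H$ and receives the fifth color; each earlier $v_j$ has a fifth-colored neighbor outside $H$, lowering its effective degree by one.) -}

module Defs where

open import Data.Nat using (ℕ; zero; suc; _+_; _*_; _≤_; _<_; _>_; _/_)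
open import Data.Bool using (Bool; true; false; if_then_else_; _∧_; _∨_)
open import Data.Fin using (Fin)
open import Data.Fin.Properties using (_≟_)
open import Data.List using (List; []; _∷_; _++_; [_]; length; lookup; take; filter; allFin)
open import Data.List.Relation.Unary.Unique.Propositional using (Unique)
open import Data.List.Membership.Propositional using (_∈_)
open import Data.Integer as ℤ using (ℤ; +_)
open import Data.Product using (Σ; ∃; ∃-syntax; _×_; _,_)
open import Data.Unit using (⊤)
open import Function.Bundles using (_⇔_)
open import Relation.Binary.PropositionalEquality using (_≡_)
open import Relation.Nullary.Decidable using (⌊_⌋)
open import Data.Nat.ListAction using (sum)

countB : ∀ {n} → (Fin n → Bool) → ℕ
countB {n} p = length (filter (λ x → p x Data.Bool.≟ true) (allFin n))

countL : ∀ {n} → (Fin n → Bool) → List (Fin n) → ℕ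
countL p [] = 0
countL p (x ∷ xs) = (if p x then 1 else 0) + countL p xs

elemB : ∀ {n} → Fin n → List (Fin n) → Bool
elemB x [] = false
elemB x (y ∷ ys) = ⌊ x ≟ y ⌋ ∨ elemB x ys

[_]ᶻ : Bool → ℤ
[ b ]ᶻ = if b then + 1 else + 0

iter : ∀ {A : Set} → (A → A) → ℕ → A → A
iter f zero a = a
iter f (suc k) a = f (iter f k a)

record SimpleGraph (n : ℕ) : Set where
  field
    Adj   : Fin n → Fin n → Bool
    sym   : ∀ u v → Adj u v ≡ Adj v u
    irrfl : ∀ v → Adj v v ≡ false
open SimpleGraph public

deg : ∀ {n} → SimpleGraph n → Fin n → ℕ
deg G v = countB (Adj G v)

data Walk {n} (E : Fin n → Fin n → Bool) : Fin n → Fin n → Set where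
  here  : ∀ {u} → Walk E u u
  there : ∀ {u v w} → E u v ≡ true → Walk E v w → Walk E u w

ConnectedGraph : ∀ {n} → SimpleGraph n → Set
ConnectedGraph {n} G = ∀ (u v : Fin n) → Walk (Adj G) u v

-- A rotation system assigns to each vertex v a map rot v whose
-- restriction to the neighbours of v is a single cyclic permutation
-- (the counterclockwise order of the edges at v).  Faces are the orbits
-- of the dart map (u , v) ↦ (v , rot v u).  The triangulation condition
-- says every face orbit has length 3, and the embedding is spherical
-- iff (G connected and) Euler's formula V - E + F = 2 holds, where
-- E = (#darts)/2 and, all faces being triangles, F = (#darts)/3.

record RotationSystem {n} (G : SimpleGraph n) : Set where
  field
    rot      : Fin n → Fin n → Fin n
    rot-adj  : ∀ v u → Adj G v u ≡ true → Adj G v (rot v u) ≡ true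
    rot-cyc  : ∀ v u w → Adj G v u ≡ true → Adj G v w ≡ true →
               ∃[ k ] iter (rot v) k u ≡ w
open RotationSystem public

numDarts : ∀ {n} → SimpleGraph n → ℕ
numDarts {n} G = sum (Data.List.map (deg G) (allFin n))

record PlaneTriangulation (n : ℕ) : Set where
  field
    graph     : SimpleGraph n
    connected : ConnectedGraph graph
    rotation  : RotationSystem graph
    triangular : ∀ u v → Adj graph u v ≡ true →
                 (rot rotation (rot rotation v u) v ≡ u) ×
                 (rot rotation u (rot rotation v u) ≡ v)
    euler : n + numDarts graph / 3 ≡ numDarts graph / 2 + 2
open PlaneTriangulation public

record Subgraph (n : ℕ) : Set where
  field
    VH : Fin n → Bool
    EH : Fin n → Fin n → Bool
    EH-sym : ∀ u v → EH u v ≡ EH v u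
    EH-V   : ∀ u v → EH u v ≡ true → VH u ≡ true
open Subgraph public

degH : ∀ {n} → Subgraph n → Fin n → ℕ
degH H v = countB (EH H v)

sizeH : ∀ {n} → Subgraph n → ℕ
sizeH H = countB (VH H)

delete : ∀ {n} → Subgraph n → Fin n → Subgraph n
delete {n} H x = record
  { VH = λ u → VH H u ∧ notB u
  ; EH = λ u v → EH H u v ∧ notB u ∧ notB v
  ; EH-sym = λ u v → symP u v
  ; EH-V = λ u v e → vP u v e }
  where
  open import Data.Bool using (not)
  open import Data.Bool.Properties using (∧-comm; ∧-assoc)
  open import Relation.Binary.PropositionalEquality using (cong₂; trans; cong)
  notB : Fin n → Bool
  notB u = not ⌊ u ≟ x ⌋
  symP : ∀ u v → (EH H u v ∧ notB u ∧ notB v) ≡ (EH H v u ∧ notB v ∧ notB u)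
  symP u v rewrite EH-sym H u v with EH H v u | notB u | notB v
  ... | true  | true  | true  = Relation.Binary.PropositionalEquality.refl
  ... | true  | true  | false = Relation.Binary.PropositionalEquality.refl
  ... | true  | false | true  = Relation.Binary.PropositionalEquality.refl
  ... | true  | false | false = Relation.Binary.PropositionalEquality.refl
  ... | false | _     | _     = Relation.Binary.PropositionalEquality.refl
  vP : ∀ u v → (EH H u v ∧ notB u ∧ notB v) ≡ true → (VH H u ∧ notB u) ≡ true
  vP u v e with EH H u v in eq | notB u
  ... | true | true rewrite EH-V H u v eq = Relation.Binary.PropositionalEquality.refl
  vP u v () | true | false
  vP u v () | false | _

-- the deletion sequence w₁ … wₙ (given as the remaining list, with the
-- already deleted prefix as accumulator) satisfies
-- δ(w_t) - |{s < t : w_s w_t ∈ E(H)}| ≤ 4 at every step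
DeletionOK : ∀ {n} → Subgraph n → (Fin n → ℤ) → List (Fin n) → List (Fin n) → Set
DeletionOK H δ pre [] = ⊤
DeletionOK H δ pre (w ∷ ws) =
  (δ w ℤ.- + countL (λ s → EH H s w) pre ℤ.≤ + 4) × DeletionOK H δ (pre ++ [ w ]) ws

ZeroReducible : ∀ {n} → Subgraph n → (Fin n → ℤ) → Set
ZeroReducible {n} H δ =
  Σ (List (Fin n)) λ ws →
    Unique ws × (∀ w → (w ∈ ws) ⇔ (VH H w ≡ true)) × DeletionOK H δ [] ws

-- The rotation data Π_H is
-- determined by G's rotation system and H, so a configuration is given
-- by a connected subgraph H of G; its degree function is d_G|V(H).

record Configuration {n} (G : PlaneTriangulation n) : Set where
  field
    sub       : Subgraph n
    sub-edges : ∀ u v → EH sub u v ≡ true → Adj (graph G) u v ≡ true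
    sub-conn  : ∀ u v → VH sub u ≡ true → VH sub v ≡ true → Walk (EH sub) u v
open Configuration public

dG : ∀ {n} → PlaneTriangulation n → Fin n → ℤ
dG G v = + deg (graph G) v

ZeroReducibleConf : ∀ {n} {G : PlaneTriangulation n} → Configuration G → Set
ZeroReducibleConf {G = G} 𝓗 = ZeroReducible (sub 𝓗) (dG G)

SixthReducibleConf : ∀ {n} {G : PlaneTriangulation n} → Configuration G → Set
SixthReducibleConf {n} {G} 𝓗 =
  6 ≤ sizeH H ×
  Σ (List (Fin n)) λ vs →
    Unique vs × (∀ v → v ∈ vs → VH H v ≡ true) ×
    (∀ (i : Fin (length vs)) →
       (∀ (j : Fin (length vs)) → Data.Fin.toℕ j < Data.Fin.toℕ i →
          deg (graph G) (lookup vs j) > degH H (lookup vs j)) →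
       ZeroReducible (delete H (lookup vs i))
         (λ w → dG G w ℤ.- [ EH H w (lookup vs i) ]ᶻ
                       ℤ.- [ elemB w (take (Data.Fin.toℕ i) vs) ]ᶻ)) ×
    ((∀ (j : Fin (length vs)) →
        deg (graph G) (lookup vs j) > degH H (lookup vs j)) →
     ZeroReducible H (λ w → dG G w ℤ.- [ elemB w vs ]ᶻ))
  where H = sub 𝓗

record SubgraphIso {n} (H H' : Subgraph n) : Set where
  field
    to    : Fin n → Fin n
    from  : Fin n → Fin n
    to-V   : ∀ v → VH H v ≡ true → VH H' (to v) ≡ true
    from-V : ∀ v → VH H' v ≡ true → VH H (from v) ≡ true
    from-to : ∀ v → VH H v ≡ true → from (to v) ≡ v
    to-from : ∀ v → VH H' v ≡ true → to (from v) ≡ v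
    to-E  : ∀ u v → VH H u ≡ true → VH H v ≡ true → EH H' (to u) (to v) ≡ EH H u v
open SubgraphIso public

{-# OPTIONS --safe #-}
module Submission where

-- Transport everything along φ⁻¹.  A deletion order (or trial sequence) of H' maps to one
-- of H: adjacency is preserved, so each vertex has the same number of already deleted
-- neighbours, while the effective degrees can only drop.  For 1/6-reducibility the guard of
-- condition (i) also transports: if d_G(v) > deg_H(v) then
-- d_G(φ v) ≥ d_G(v) > deg_H(v) ≥ deg_H'(φ v), so every case that H must handle is a case
-- that H' handles.

open import Defs hiding (sym)
open import Data.Bool using (Bool; true; not; _∧_; _∨_; if_then_else_)
open import Data.Bool.Properties using (∧-conicalˡ)
import Data.Bool.Properties as Bool
open import Data.Fin using (Fin; toℕ; cast) renaming (zero to fzero; suc to fsuc)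
open import Data.Fin.Properties using (_≟_; toℕ-cast)
open import Data.Integer as ℤ using (ℤ; +≤+)
import Data.Integer.Properties as ℤ
open import Data.List using (List; []; _∷_; _++_; [_]; map; length; lookup; take; filter; allFin)
open import Data.List.Properties using (map-++; length-map; take-map)
open import Data.List.Membership.Propositional using (_∈_)
open import Data.List.Membership.Propositional.Properties
  using (∈-map⁺; ∈-∃++; ∈-filter⁺; ∈-allFin; ∈-lookup)
open import Data.List.Relation.Binary.Permutation.Propositional.Properties
  using (shift; ∈-resp-↭; ↭-length)
open import Data.List.Relation.Binary.Subset.Propositional using (_⊆_)
open import Data.List.Relation.Unary.All as All using (All; []; _∷_)
import Data.List.Relation.Unary.All.Properties as All
open import Data.List.Relation.Unary.AllPairs using ([]; _∷_)
import Data.List.Relation.Unary.Any as Any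
open import Data.List.Relation.Unary.Unique.Propositional using (Unique)
open import Data.List.Relation.Unary.Unique.Propositional.Properties using (allFin⁺; filter⁺)
open import Data.Nat using (suc; _+_; z≤n; s≤s; _≤_; _<_)
open import Data.Nat.Properties using (≤-trans; <-≤-trans; ≤-<-trans; module ≤-Reasoning)
open import Data.Product using (_×_; _,_)
open import Data.Unit using (tt)
open import Function using (_∘_)
open import Function.Bundles using (Equivalence; mk⇔)
open import Relation.Binary.PropositionalEquality
  using (_≡_; refl; sym; trans; cong; cong₂; subst; subst₂; module ≡-Reasoning)
open import Relation.Nullary.Decidable using (⌊_⌋; does; isYes≗does; does-⇔)

Unique⇒length≤ : ∀ {A : Set} {xs ys : List A} → Unique xs → xs ⊆ ys → length xs ≤ length ys
Unique⇒length≤ [] _ = z≤n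
Unique⇒length≤ {xs = x ∷ xs} (x∉xs ∷ !xs) xs⊆ys with ∈-∃++ (xs⊆ys (Any.here refl))
... | as , bs , refl = begin
  suc (length xs)         ≤⟨ s≤s (Unique⇒length≤ !xs xs⊆as++bs) ⟩
  suc (length (as ++ bs)) ≡⟨ ↭-length (shift x as bs) ⟨
  length (as ++ x ∷ bs)   ∎
  where
  open ≤-Reasoning
  xs⊆as++bs : xs ⊆ as ++ bs
  xs⊆as++bs y∈xs = Any.tail (All.lookup x∉xs y∈xs ∘ sym)
                            (∈-resp-↭ (shift x as bs) (xs⊆ys (Any.there y∈xs)))

length≤countB : ∀ {n} {p : Fin n → Bool} {xs : List (Fin n)} →
                Unique xs → All (λ x → p x ≡ true) xs → length xs ≤ countB p
length≤countB {p = p} !xs pxs =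
  Unique⇒length≤ !xs λ {x} x∈xs →
    ∈-filter⁺ (λ x → p x Bool.≟ true) (∈-allFin x) (All.lookup pxs x∈xs)

countL-map : ∀ {m n} (p : Fin n → Bool) (f : Fin m → Fin n) (xs : List (Fin m)) →
             countL p (map f xs) ≡ countL (p ∘ f) xs
countL-map p f []       = refl
countL-map p f (x ∷ xs) = cong (_ +_) (countL-map p f xs)

countL-cong : ∀ {n} {p q : Fin n → Bool} {xs : List (Fin n)} →
              All (λ x → p x ≡ q x) xs → countL p xs ≡ countL q xs
countL-cong []                 = refl
countL-cong (px≡qx ∷ pxs≡qxs) =
  cong₂ (λ b c → (if b then 1 else 0) + c) px≡qx (countL-cong pxs≡qxs)

lookup-map : ∀ {A B : Set} (f : A → B) (xs : List A) (i : Fin (length (map f xs))) →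
             lookup (map f xs) i ≡ f (lookup xs (cast (length-map f xs) i))
lookup-map f (x ∷ xs) fzero    = refl
lookup-map f (x ∷ xs) (fsuc i) = lookup-map f xs i

lookup-map-cast⁻ : ∀ {A B : Set} (f : A → B) (xs : List A) (i : Fin (length xs)) →
                   lookup (map f xs) (cast (sym (length-map f xs)) i) ≡ f (lookup xs i)
lookup-map-cast⁻ f (x ∷ xs) fzero    = refl
lookup-map-cast⁻ f (x ∷ xs) (fsuc i) = lookup-map-cast⁻ f xs i

Vertex : ∀ {n} → Subgraph n → Fin n → Set
Vertex K v = VH K v ≡ true

iso-sym : ∀ {n} {K K' : Subgraph n} → SubgraphIso K K' → SubgraphIso K' K
iso-sym {K' = K'} ψ = record
  { to      = from ψ
  ; from    = to ψ
  ; to-V    = from-V ψ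
  ; from-V  = to-V ψ
  ; from-to = to-from ψ
  ; to-from = from-to ψ
  ; to-E    = λ u v hu hv →
      trans (sym (to-E ψ (from ψ u) (from ψ v) (from-V ψ u hu) (from-V ψ v hv)))
            (cong₂ (EH K') (to-from ψ u hu) (to-from ψ v hv))
  }

module _ {n} {K K' : Subgraph n} (ψ : SubgraphIso K K') where

  to-injective : ∀ {u v} → Vertex K u → Vertex K v → to ψ u ≡ to ψ v → u ≡ v
  to-injective {u} {v} hu hv eq = begin
    u               ≡⟨ from-to ψ u hu ⟨
    from ψ (to ψ u) ≡⟨ cong (from ψ) eq ⟩
    from ψ (to ψ v) ≡⟨ from-to ψ v hv ⟩
    v               ∎
    where open ≡-Reasoning

  to-≟ : ∀ {u v} → Vertex K u → Vertex K v → ⌊ to ψ u ≟ to ψ v ⌋ ≡ ⌊ u ≟ v ⌋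
  to-≟ {u} {v} hu hv = begin
    ⌊ to ψ u ≟ to ψ v ⌋    ≡⟨ isYes≗does _ ⟩
    does (to ψ u ≟ to ψ v) ≡⟨ does-⇔ to≡to⇔≡ (to ψ u ≟ to ψ v) (u ≟ v) ⟩
    does (u ≟ v)           ≡⟨ isYes≗does _ ⟨
    ⌊ u ≟ v ⌋              ∎
    where
    open ≡-Reasoning
    to≡to⇔≡ = mk⇔ (to-injective hu hv) (cong (to ψ))

  Unique-map-to : ∀ {xs} → All (Vertex K) xs → Unique xs → Unique (map (to ψ) xs)
  Unique-map-to []         []            = []
  Unique-map-to (hx ∷ hxs) (x∉xs ∷ !xs) =
    All.map⁺ (All.zipWith (λ (hy , x≢y) → x≢y ∘ to-injective hx hy) (hxs , x∉xs))
    ∷ Unique-map-to hxs !xs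

  elemB-map-to : ∀ {w xs} → Vertex K w → All (Vertex K) xs →
                 elemB (to ψ w) (map (to ψ) xs) ≡ elemB w xs
  elemB-map-to hw []         = refl
  elemB-map-to hw (hx ∷ hxs) = cong₂ _∨_ (to-≟ hw hx) (elemB-map-to hw hxs)

  map-to-Vertex : ∀ {xs} → All (Vertex K) xs → All (Vertex K') (map (to ψ) xs)
  map-to-Vertex = All.map⁺ ∘ All.map (to-V ψ _)

  countL-EH-map-to : ∀ {w pre} → Vertex K w → All (Vertex K) pre →
                     countL (λ s → EH K' s (to ψ w)) (map (to ψ) pre) ≡ countL (λ s → EH K s w) pre
  countL-EH-map-to {w} {pre} hw hpre =
    trans (countL-map _ (to ψ) pre) (countL-cong (All.map (λ hs → to-E ψ _ w hs hw) hpre))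

  DeletionOK-map : ∀ {δ δ'} → (∀ v → Vertex K v → δ' (to ψ v) ℤ.≤ δ v) →
                   ∀ {pre} ws → All (Vertex K) pre → All (Vertex K) ws →
                   DeletionOK K δ pre ws → DeletionOK K' δ' (map (to ψ) pre) (map (to ψ) ws)
  DeletionOK-map δ'≤δ []       _    _          _          = tt
  DeletionOK-map {δ} {δ'} δ'≤δ {pre} (w ∷ ws) hpre (hw ∷ hws) (ok , oks) =
    ℤ.≤-trans step ok ,
    subst (λ pre' → DeletionOK K' δ' pre' (map (to ψ) ws)) (map-++ (to ψ) pre [ w ])
          (DeletionOK-map δ'≤δ ws (All.++⁺ hpre (hw ∷ [])) hws oks)
    where
    step : δ' (to ψ w) ℤ.- ℤ.+ countL (λ s → EH K' s (to ψ w)) (map (to ψ) pre)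
           ℤ.≤ δ w ℤ.- ℤ.+ countL (λ s → EH K s w) pre
    step rewrite countL-EH-map-to hw hpre = ℤ.+-monoˡ-≤ _ (δ'≤δ w hw)

  ZeroReducible-map : ∀ {δ δ'} → (∀ v → Vertex K v → δ' (to ψ v) ℤ.≤ δ v) →
                      ZeroReducible K δ → ZeroReducible K' δ'
  ZeroReducible-map δ'≤δ (ws , !ws , ws⇔V , ok) =
    map (to ψ) ws , Unique-map-to hws !ws ,
    (λ w → mk⇔ (All.lookup (map-to-Vertex hws)) (Vertex⇒∈ w)) ,
    DeletionOK-map δ'≤δ ws [] hws ok
    where
    hws : All (Vertex K) ws
    hws = All.tabulate (Equivalence.to (ws⇔V _))
    Vertex⇒∈ : ∀ w → Vertex K' w → w ∈ map (to ψ) ws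
    Vertex⇒∈ w hw = subst (_∈ map (to ψ) ws) (to-from ψ w hw)
                          (∈-map⁺ (to ψ) (Equivalence.from (ws⇔V (from ψ w)) (from-V ψ w hw)))

  countB-map-≤ : ∀ {p q : Fin n → Bool} → (∀ v → p v ≡ true → Vertex K v) →
                 (∀ v → p v ≡ true → q (to ψ v) ≡ true) → countB p ≤ countB q
  countB-map-≤ {p} {q} p⇒V p⇒q∘to =
    subst (_≤ countB q) (length-map (to ψ) ps)
      (length≤countB (Unique-map-to (All.map (p⇒V _) pps) (filter⁺ p? (allFin⁺ n)))
                     (All.map⁺ (All.map (p⇒q∘to _) pps)))
    where
    p? = λ x → p x Bool.≟ true
    ps = filter p? (allFin n)
    pps : All (λ x → p x ≡ true) ps
    pps = All.all-filter p? (allFin n)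

  sizeH-map-≤ : sizeH K ≤ sizeH K'
  sizeH-map-≤ = countB-map-≤ (λ _ hv → hv) (to-V ψ)

  degH-map-≤ : ∀ {v} → Vertex K v → degH K v ≤ degH K' (to ψ v)
  degH-map-≤ {v} hv =
    countB-map-≤ neighbour-Vertex (λ u e → trans (to-E ψ v u hv (neighbour-Vertex u e)) e)
    where
    neighbour-Vertex : ∀ u → EH K v u ≡ true → Vertex K u
    neighbour-Vertex u e = EH-V K u v (trans (EH-sym K u v) e)

  delete-map : ∀ {x} → Vertex K x → SubgraphIso (delete K x) (delete K' (to ψ x))
  delete-map {x} hx = record
    { to      = to ψ
    ; from    = from ψ
    ; to-V    = λ v h → let hv = vertex h in
                trans (cong₂ _∧_ (trans (to-V ψ v hv) (sym hv)) (≢x-map hv)) h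
    ; from-V  = λ v h → let hv = vertex h in
                trans (cong₂ _∧_ (trans (from-V ψ v hv) (sym hv)) (≢x-comap hv)) h
    ; from-to = λ v h → from-to ψ v (vertex h)
    ; to-from = λ v h → to-from ψ v (vertex h)
    ; to-E    = λ u v hu hv → cong₂ _∧_ (to-E ψ u v (vertex hu) (vertex hv))
                                        (cong₂ _∧_ (≢x-map (vertex hu)) (≢x-map (vertex hv)))
    }
    where
    vertex : ∀ {b c} → b ∧ c ≡ true → b ≡ true
    vertex = ∧-conicalˡ _ _
    ≢x-map : ∀ {v} → Vertex K v → not ⌊ to ψ v ≟ to ψ x ⌋ ≡ not ⌊ v ≟ x ⌋
    ≢x-map hv = cong not (to-≟ hv hx)
    ≢x-comap : ∀ {v} → Vertex K' v → not ⌊ from ψ v ≟ x ⌋ ≡ not ⌊ v ≟ to ψ x ⌋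
    ≢x-comap {v} hv =
      trans (sym (≢x-map (from-V ψ v hv))) (cong (λ y → not ⌊ y ≟ to ψ x ⌋) (to-from ψ v hv))

HasEdgeOutside : ∀ {n} → PlaneTriangulation n → Subgraph n → Fin n → Set
HasEdgeOutside G K v = degH K v < deg (graph G) v

trialDegree : ∀ {n} → PlaneTriangulation n → Subgraph n → Fin n → List (Fin n) → Fin n → ℤ
trialDegree G K x pre w = dG G w ℤ.- [ EH K w x ]ᶻ ℤ.- [ elemB w pre ]ᶻ

SixthReducibleConf-map : ∀ {n} {G : PlaneTriangulation n} {𝓗 𝓗' : Configuration G}
                         (ψ : SubgraphIso (sub 𝓗) (sub 𝓗')) →
                         (∀ v → Vertex (sub 𝓗) v → deg (graph G) (to ψ v) ≤ deg (graph G) v) →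
                         SixthReducibleConf 𝓗 → SixthReducibleConf 𝓗'
SixthReducibleConf-map {G = G} {𝓗} {𝓗'} ψ d∘ψ≤d (six≤ , vs , !vs , vs⊆K , trial , final) =
  ≤-trans six≤ (sizeH-map-≤ ψ) , map f vs , Unique-map-to ψ hvs !vs ,
  (λ _ → All.lookup (map-to-Vertex ψ hvs)) , trial' , final'
  where
  K = sub 𝓗
  K' = sub 𝓗'
  f = to ψ

  hvs : All (Vertex K) vs
  hvs = All.tabulate (vs⊆K _)

  hv : ∀ i → Vertex K (lookup vs i)
  hv i = All.lookup hvs (∈-lookup i)

  j↑ : Fin (length vs) → Fin (length (map f vs))
  j↑ = cast (sym (length-map f vs))

  outside⁻ : ∀ j → HasEdgeOutside G K' (lookup (map f vs) (j↑ j)) →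
                   HasEdgeOutside G K (lookup vs j)
  outside⁻ j out = ≤-<-trans (degH-map-≤ ψ (hv j))
    (<-≤-trans (subst (HasEdgeOutside G K') (lookup-map-cast⁻ f vs j) out) (d∘ψ≤d _ (hv j)))

  trialDegree-map : ∀ {x pre w} → Vertex K x → All (Vertex K) pre → Vertex K w →
                    trialDegree G K' (f x) (map f pre) (f w) ℤ.≤ trialDegree G K x pre w
  trialDegree-map {x} {pre} {w} hx hpre hw
    rewrite to-E ψ w x hw hx | elemB-map-to ψ hw hpre =
    ℤ.+-monoˡ-≤ (ℤ.- [ elemB w pre ]ᶻ) (ℤ.+-monoˡ-≤ (ℤ.- [ EH K w x ]ᶻ) (+≤+ (d∘ψ≤d w hw)))

  trial' : ∀ i → (∀ j → toℕ j < toℕ i → HasEdgeOutside G K' (lookup (map f vs) j)) →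
           ZeroReducible (delete K' (lookup (map f vs) i))
                         (trialDegree G K' (lookup (map f vs) i) (take (toℕ i) (map f vs)))
  trial' i earlier rewrite lookup-map f vs i | take-map {f = f} (toℕ i) vs =
    ZeroReducible-map (delete-map ψ (hv i'))
      (λ w hw → trialDegree-map (hv i') (All.take⁺ (toℕ i) hvs) (∧-conicalˡ _ _ hw))
      (subst (λ k → ZeroReducible (delete K (lookup vs i')) (trialDegree G K (lookup vs i') (take k vs)))
             (toℕ-cast _ i) (trial i' earlier⁻))
    where
    i' = cast (length-map f vs) i
    earlier⁻ : ∀ j → toℕ j < toℕ i' → HasEdgeOutside G K (lookup vs j)
    earlier⁻ j j<i' =
      outside⁻ j (earlier (j↑ j) (subst₂ _<_ (sym (toℕ-cast _ j)) (toℕ-cast _ i) j<i'))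

  final' : (∀ j → HasEdgeOutside G K' (lookup (map f vs) j)) →
           ZeroReducible K' (λ w → dG G w ℤ.- [ elemB w (map f vs) ]ᶻ)
  final' all-outside =
    ZeroReducible-map ψ finalDegree-map (final (λ j → outside⁻ j (all-outside (j↑ j))))
    where
    finalDegree-map : ∀ w → Vertex K w →
                      dG G (f w) ℤ.- [ elemB (f w) (map f vs) ]ᶻ ℤ.≤ dG G w ℤ.- [ elemB w vs ]ᶻ
    finalDegree-map w hw rewrite elemB-map-to ψ hw hvs =
      ℤ.+-monoˡ-≤ (ℤ.- [ elemB w vs ]ᶻ) (+≤+ (d∘ψ≤d w hw))

lemma3p3 : ∀ {n} (G : PlaneTriangulation n) (𝓗 𝓗' : Configuration G)
           (φ : SubgraphIso (sub 𝓗) (sub 𝓗')) →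
           (∀ v → VH (sub 𝓗) v ≡ true → deg (graph G) v ≤ deg (graph G) (to φ v)) →
           (ZeroReducibleConf 𝓗' → ZeroReducibleConf 𝓗) ×
           (SixthReducibleConf 𝓗' → SixthReducibleConf 𝓗)
lemma3p3 G 𝓗 𝓗' φ d≤d∘φ =
  ZeroReducible-map φ⁻¹ (λ v hv → +≤+ (d∘φ⁻¹≤d v hv)) ,
  SixthReducibleConf-map {𝓗 = 𝓗'} {𝓗} φ⁻¹ d∘φ⁻¹≤d
  where
  φ⁻¹ = iso-sym φ
  d∘φ⁻¹≤d : ∀ v → Vertex (sub 𝓗') v → deg (graph G) (from φ v) ≤ deg (graph G) v
  d∘φ⁻¹≤d v hv = subst (λ u → deg (graph G) (from φ v) ≤ deg (graph G) u) (to-from φ v hv)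
                       (d≤d∘φ (from φ v) (from-V φ v hv))
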